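{- Let $p>5$ be prime. Then for each $i\in\{1,2,3\}$, \[\mathrm{ord}_{p,i}(1,1,1)=\frac{\pi(p)}{2},\] where $\pi(p)$ is the Pisano period of the Fibonacci sequence modulo $p$.
   Context: The point $(1,1,1)$ is a solution of the Markoff equation $x_1^2+x_2^2+x_3^2=3x_1x_2x_3$ over $\mathbb{F}_p$. The rotations are the maps $\mathrm{rot}_1(x_1,x_2,x_3)=(x_1,x_3,3x_1x_3-x_2)$, $\mathrm{rot}_2(x_1,x_2,x_3)=(x_3,x_2,3x_2x_3-x_1)$, $\mathrm{rot}_3(x_1,x_2,x_3)=(x_2,3x_2x_3-x_1,x_3)$ on $\mathbb{F}_p^3$, and $\mathrm{ord}_{p,i}(\mathbf{x})=\min\{n\in\mathbb{Z}_{>0}:\mathrm{rot}_i^n(\mathbf{x})\equiv\mathbf{x}\pmod p\}$. The Fibonacci sequence is $f_0=0,f_1=1,f_{n+1}=f_n+f_{n-1}$, and the Pisano period $\pi(n)$ is the smallest positive integer $k$ with $f_k\equiv 0$ and $f_{k+1}\equiv 1\pmod n$. -}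

module Defs where

open import Data.Nat using (ℕ; zero; suc; _+_; _*_; _∸_; _<_; _%_; NonZero)
open import Data.Nat.Primality using (Prime)
open import Data.Fin using (Fin; zero; suc)
open import Data.Product using (_×_; _,_)
open import Data.Empty using (⊥)
open import Function using (_∘_)
open import Relation.Binary.PropositionalEquality using (_≡_)

-- Points of F_p^3, with F_p represented by natural numbers (residues mod p).
Point : Set
Point = ℕ × ℕ × ℕ

module _ (p : ℕ) .{{_ : NonZero p}} where

  subMod : ℕ → ℕ → ℕ
  subMod a b = (a % p + (p ∸ b % p)) % p

  markoffNext : ℕ → ℕ → ℕ → ℕ
  markoffNext x y z = subMod (3 * x * y) z

  rot₁ rot₂ rot₃ : Point → Point
  rot₁ (x₁ , x₂ , x₃) = (x₁ % p , x₃ % p , markoffNext x₁ x₃ x₂)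
  rot₂ (x₁ , x₂ , x₃) = (x₃ % p , x₂ % p , markoffNext x₂ x₃ x₁)
  rot₃ (x₁ , x₂ , x₃) = (x₂ % p , markoffNext x₂ x₃ x₁ , x₃ % p)

  rot : Fin 3 → Point → Point
  rot zero = rot₁
  rot (suc zero) = rot₂
  rot (suc (suc zero)) = rot₃

  _≡ₚ_ : Point → Point → Set
  (a₁ , a₂ , a₃) ≡ₚ (b₁ , b₂ , b₃) =
    (a₁ % p ≡ b₁ % p) × (a₂ % p ≡ b₂ % p) × (a₃ % p ≡ b₃ % p)

  IsOrd : Fin 3 → Point → ℕ → Set
  IsOrd i x n =
    (0 < n) × (iter n (rot i) x ≡ₚ x) ×
    (∀ m → 0 < m → m < n → iter m (rot i) x ≡ₚ x → ⊥)
    where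
      iter : ℕ → (Point → Point) → Point → Point
      iter zero f y = y
      iter (suc k) f y = f (iter k f y)

fib : ℕ → ℕ
fib zero = 0
fib (suc zero) = 1
fib (suc (suc n)) = fib (suc n) + fib n

IsPisanoPeriod : (n : ℕ) .{{_ : NonZero n}} → ℕ → Set
IsPisanoPeriod n k =
  (0 < k) × (fib k % n ≡ 0 % n) × (fib (suc k) % n ≡ 1 % n) ×
  (∀ m → 0 < m → m < k → fib m % n ≡ 0 % n → fib (suc m) % n ≡ 1 % n → ⊥)

{-# OPTIONS --safe #-}
module Submission where

open import Defs
open import Data.Nat using (ℕ; _<_; _/_; NonZero)
open import Data.Nat.Primality using (Prime)
open import Data.Fin using (Fin)
open import Data.Product using (_,_)

open import Data.Nat using (zero; suc; _+_; _*_; _∸_; _%_; z≤n; s≤s)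
open import Data.Nat.Properties
  using (1+n≢0; +-suc; +-comm; +-assoc; +-identityʳ; *-identityʳ; +-mono-<; <-trans; m+[n∸m]≡n)
open import Data.Nat.DivMod
  using (m%n%n≡m%n; m%n≤n; m%n<n; m≡m%n+[m/n]*n; [m+n]%n≡m%n; %-distribˡ-+; %-distribˡ-*; m<n⇒m%n≡m)
open import Data.Nat.Tactic.RingSolver using (solve-∀)
open import Data.Fin using (zero; suc)
open import Data.Product using (_×_; proj₁; proj₂)
open import Data.Sum using (_⊎_; inj₁; inj₂)
open import Data.Empty using (⊥; ⊥-elim)
open import Function.Bundles using (_⇔_; mk⇔; Equivalence)
open import Function.Construct.Composition using (_⇔-∘_)
open import Relation.Nullary using (¬_)
open import Relation.Binary.PropositionalEquality using (_≡_; refl; sym; trans; cong; subst; module ≡-Reasoning)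

open Equivalence using (to; from)
open ≡-Reasoning

-- Put a₀ = 1 and aₙ = F₂ₙ₋₁. These satisfy aₙ₊₂ = 3aₙ₊₁ − aₙ, which is the
-- Markoff move with the fixed coordinate equal to 1, so rotᵢⁿ(1,1,1) is
-- (1,1,1) with its two moving coordinates replaced by (aₙ, aₙ₊₁). It is back at
-- (1,1,1) iff F₂ₙ₋₁ ≡ F₂ₙ₊₁ ≡ 1, i.e. iff F₂ₙ ≡ 0 and F₂ₙ₊₁ ≡ 1, i.e. iff 2n is
-- a period of the Fibonacci sequence mod p. By Cassini's identity an odd
-- period would force 1 + 1 ≡ 0, so for p > 2 the Pisano period is even and the
-- least such n is π(p)/2.

evenBit : ℕ → ℕ
evenBit zero = 1
evenBit (suc zero) = 0
evenBit (suc (suc n)) = evenBit n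

evenBit-double : ∀ m → evenBit (m + m) ≡ 1
evenBit-double zero = refl
evenBit-double (suc m) rewrite +-suc m m = evenBit-double m

evenBit-suc-double : ∀ m → evenBit (suc (m + m)) ≡ 0
evenBit-suc-double zero = refl
evenBit-suc-double (suc m) rewrite +-suc m m = evenBit-suc-double m

cassini-step : ∀ a b {e e′} → a * (b + a) + e ≡ b * b + e′ →
               b * ((b + a) + b) + e′ ≡ (b + a) * (b + a) + e
cassini-step a b {e} {e′} h = begin
  b * ((b + a) + b) + e′           ≡⟨ expand a b e′ ⟩
  b * (b + a) + (b * b + e′)       ≡⟨ cong (b * (b + a) +_) h ⟨
  b * (b + a) + (a * (b + a) + e)  ≡⟨ collect a b e ⟩
  (b + a) * (b + a) + e            ∎
  where
  expand : ∀ a b e′ → b * ((b + a) + b) + e′ ≡ b * (b + a) + (b * b + e′)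
  expand = solve-∀
  collect : ∀ a b e → b * (b + a) + (a * (b + a) + e) ≡ (b + a) * (b + a) + e
  collect = solve-∀

-- In ℤ, evenBit n − evenBit (suc n) = (−1)ⁿ, so this is Cassini's identity
-- Fₙ₊₁² − Fₙ Fₙ₊₂ = (−1)ⁿ written without subtraction.
cassini : ∀ n → fib n * fib (suc (suc n)) + evenBit n ≡ fib (suc n) * fib (suc n) + evenBit (suc n)
cassini zero = refl
cassini (suc n) = cassini-step (fib n) (fib (suc n)) (cassini n)

-- oddFib n = F₂ₙ₋₁, extended by F₋₁ = 1.
oddFib : ℕ → ℕ
oddFib zero = 1
oddFib (suc n) = fib (suc (n + n))

oddFib-rec : ∀ n → oddFib (suc (suc n)) + oddFib n ≡ 3 * oddFib (suc n)
oddFib-rec zero = refl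
oddFib-rec (suc n) rewrite +-suc n (suc n) | +-suc n n =
  triple (fib (suc (suc (n + n)))) (fib (suc (n + n)))
  where
  triple : ∀ x y → ((x + y) + x) + (x + y) + y ≡ 3 * (x + y)
  triple = solve-∀

half-or-odd : ∀ k → k ≡ k / 2 + k / 2 ⊎ k ≡ suc (k / 2 + k / 2)
half-or-odd k = by-remainder (k % 2) (m%n<n k 2)
  (trans (m≡m%n+[m/n]*n k 2) (cong (k % 2 +_) (n*2≡n+n (k / 2))))
  where
  n*2≡n+n : ∀ n → n * 2 ≡ n + n
  n*2≡n+n = solve-∀
  by-remainder : ∀ r → r < 2 → k ≡ r + (k / 2 + k / 2) → k ≡ k / 2 + k / 2 ⊎ k ≡ suc (k / 2 + k / 2)
  by-remainder 0 _ k≡ = inj₁ k≡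
  by-remainder 1 _ k≡ = inj₂ k≡
  by-remainder (suc (suc _)) (s≤s (s≤s ())) _

LeastPositive : (ℕ → Set) → ℕ → Set
LeastPositive P n = 0 < n × P n × (∀ m → 0 < m → m < n → P m → ⊥)

LeastPositive-half : ∀ {P Q : ℕ → Set} {m} → (∀ n → 0 < n → P n ⇔ Q (n + n)) →
                     LeastPositive Q (m + m) → LeastPositive P m
LeastPositive-half {m = zero} _ (() , _)
LeastPositive-half {m = suc m} P⇔Q (_ , Q2m , least) =
  s≤s z≤n , from (P⇔Q (suc m) (s≤s z≤n)) Q2m ,
  λ j 0<j j<m Pj → least (j + j) (+-mono-< 0<j 0<j) (+-mono-< j<m j<m) (to (P⇔Q j 0<j) Pj)

insertOne : Fin 3 → ℕ → ℕ → Point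
insertOne zero a b = (1 , a , b)
insertOne (suc zero) a b = (a , 1 , b)
insertOne (suc (suc zero)) a b = (a , b , 1)

IsOrbit : (Point → Point) → Point → (ℕ → Point) → Set
IsOrbit f x G = G 0 ≡ x × (∀ n → G (suc n) ≡ f (G n))

module _ (p : ℕ) .{{_ : NonZero p}} where

  infix 4 _≈_ _≋_

  _≈_ : ℕ → ℕ → Set
  a ≈ b = a % p ≡ b % p

  _≋_ : Point → Point → Set
  _≋_ = _≡ₚ_ p

  %-≈ : ∀ {a b} → a ≈ b → a % p ≈ b
  %-≈ {a} a≈b = trans (m%n%n≡m%n a p) a≈b

  +-cong : ∀ {a a′ b b′} → a ≈ a′ → b ≈ b′ → a + b ≈ a′ + b′
  +-cong {a} {a′} {b} {b′} a≈a′ b≈b′ = begin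
    (a + b) % p                ≡⟨ %-distribˡ-+ a b p ⟩
    (a % p + b % p) % p        ≡⟨ cong (λ x → (x + b % p) % p) a≈a′ ⟩
    (a′ % p + b % p) % p       ≡⟨ cong (λ y → (a′ % p + y) % p) b≈b′ ⟩
    (a′ % p + b′ % p) % p      ≡⟨ %-distribˡ-+ a′ b′ p ⟨
    (a′ + b′) % p              ∎

  *-cong : ∀ {a a′ b b′} → a ≈ a′ → b ≈ b′ → a * b ≈ a′ * b′
  *-cong {a} {a′} {b} {b′} a≈a′ b≈b′ = begin
    (a * b) % p                ≡⟨ %-distribˡ-* a b p ⟩
    (a % p * (b % p)) % p      ≡⟨ cong (λ x → (x * (b % p)) % p) a≈a′ ⟩
    (a′ % p * (b % p)) % p     ≡⟨ cong (λ y → (a′ % p * y) % p) b≈b′ ⟩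
    (a′ % p * (b′ % p)) % p    ≡⟨ %-distribˡ-* a′ b′ p ⟨
    (a′ * b′) % p              ∎

  m+[p∸m%p]≈0 : ∀ m → m + (p ∸ m % p) ≈ 0
  m+[p∸m%p]≈0 m = begin
    (m + (p ∸ m % p)) % p        ≡⟨ +-cong (m%n%n≡m%n m p) refl ⟨
    (m % p + (p ∸ m % p)) % p    ≡⟨ cong (_% p) (m+[n∸m]≡n (m%n≤n m p)) ⟩
    p % p                        ≡⟨ [m+n]%n≡m%n 0 p ⟩
    0 % p                        ∎

  subMod-≈ : ∀ {a b c} → a ≈ b + c → subMod p a c ≈ b
  subMod-≈ {a} {b} {c} a≈b+c = begin
    subMod p a c % p                ≡⟨ %-≈ (+-cong (m%n%n≡m%n a p) refl) ⟩
    (a + (p ∸ c % p)) % p           ≡⟨ +-cong a≈b+c refl ⟩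
    (b + c + (p ∸ c % p)) % p       ≡⟨ cong (_% p) (+-assoc b c (p ∸ c % p)) ⟩
    (b + (c + (p ∸ c % p))) % p     ≡⟨ +-cong {b} refl (m+[p∸m%p]≈0 c) ⟩
    (b + 0) % p                     ≡⟨ cong (_% p) (+-identityʳ b) ⟩
    b % p                           ∎

  +-cancelʳ-≈ : ∀ {a b} c → a + c ≈ b + c → a ≈ b
  +-cancelʳ-≈ {a} c a+c≈b+c = trans (sym (subMod-≈ {a + c} {a} {c} refl)) (subMod-≈ a+c≈b+c)

  ≈⇒≡ : ∀ {a b} → a < p → b < p → a ≈ b → a ≡ b
  ≈⇒≡ a<p b<p a≈b = trans (sym (m<n⇒m%n≡m a<p)) (trans a≈b (m<n⇒m%n≡m b<p))

  ≋-sym : ∀ {q r} → q ≋ r → r ≋ q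
  ≋-sym {_ , _ , _} {_ , _ , _} (e₁ , e₂ , e₃) = sym e₁ , sym e₂ , sym e₃

  ≋-trans : ∀ {q r s} → q ≋ r → r ≋ s → q ≋ s
  ≋-trans {_ , _ , _} {_ , _ , _} {_ , _ , _} (e₁ , e₂ , e₃) (f₁ , f₂ , f₃) =
    trans e₁ f₁ , trans e₂ f₂ , trans e₃ f₃

  insertOne-≋-ones : ∀ i {a b} → insertOne i a b ≋ (1 , 1 , 1) ⇔ (a ≈ 1 × b ≈ 1)
  insertOne-≋-ones zero = mk⇔ proj₂ (refl ,_)
  insertOne-≋-ones (suc zero) =
    mk⇔ (λ (a≈1 , _ , b≈1) → a≈1 , b≈1) (λ (a≈1 , b≈1) → a≈1 , refl , b≈1)
  insertOne-≋-ones (suc (suc zero)) =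
    mk⇔ (λ (a≈1 , b≈1 , _) → a≈1 , b≈1) (λ (a≈1 , b≈1) → a≈1 , b≈1 , refl)

  markoffNext-≈ : ∀ x y {z a c t} → 3 * x * y ≈ t → z ≈ a → c + a ≈ t → markoffNext p x y z ≈ c
  markoffNext-≈ x y {c = c} 3xy≈t z≈a c+a≈t =
    subMod-≈ {3 * x * y} (trans 3xy≈t (trans (sym c+a≈t) (+-cong {c} refl (sym z≈a))))

  rot-insertOne : ∀ i {q a b c} → q ≋ insertOne i a b → c + a ≈ 3 * b → rot p i q ≋ insertOne i b c
  rot-insertOne zero {x , _ , z} (x≈1 , y≈a , z≈b) c+a≈3b =
    %-≈ x≈1 , %-≈ z≈b , markoffNext-≈ x z (*-cong (*-cong {3} refl x≈1) z≈b) y≈a c+a≈3b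
  rot-insertOne (suc zero) {_ , y , z} (x≈a , y≈1 , z≈b) c+a≈3b =
    %-≈ z≈b , %-≈ y≈1 , markoffNext-≈ y z (*-cong (*-cong {3} refl y≈1) z≈b) x≈a c+a≈3b
  rot-insertOne (suc (suc zero)) {_ , y , z} {b = b} (x≈a , y≈b , z≈1) c+a≈3b =
    %-≈ y≈b , markoffNext-≈ y z 3yz≈3b x≈a c+a≈3b , %-≈ z≈1
    where
    3yz≈3b = trans (*-cong (*-cong {3} refl y≈b) z≈1) (cong (_% p) (*-identityʳ (3 * b)))

  orbit-≋-oddFib : ∀ i {G} → IsOrbit (rot p i) (1 , 1 , 1) G →
                   ∀ n → G n ≋ insertOne i (oddFib n) (oddFib (suc n))
  orbit-≋-oddFib i (G0 , _) zero rewrite G0 = ≋-sym (from (insertOne-≋-ones i) (refl , refl))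
  orbit-≋-oddFib i orbit@(_ , Gsuc) (suc n) rewrite Gsuc n =
    rot-insertOne i (orbit-≋-oddFib i orbit n) (cong (_% p) (oddFib-rec n))

  orbit-returns⇔oddFib-ones : ∀ i {G} → IsOrbit (rot p i) (1 , 1 , 1) G →
                              ∀ n → G n ≋ (1 , 1 , 1) ⇔ (oddFib n ≈ 1 × oddFib (suc n) ≈ 1)
  orbit-returns⇔oddFib-ones i orbit n = insertOne-≋-ones i ⇔-∘ mk⇔
    (λ Gn≋1 → ≋-trans (≋-sym Gn≋inserted) Gn≋1)
    (λ inserted≋1 → ≋-trans Gn≋inserted inserted≋1)
    where
    Gn≋inserted = orbit-≋-oddFib i orbit n

  FibPeriod : ℕ → Set
  FibPeriod k = fib k ≈ 0 × fib (suc k) ≈ 1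

  FibPeriod⇒fib-pred≈1 : ∀ t → FibPeriod (suc t) → fib t ≈ 1
  FibPeriod⇒fib-pred≈1 t (f₁≈0 , f₂≈1) = +-cancelʳ-≈ (fib (suc t)) (begin
    (fib t + fib (suc t)) % p   ≡⟨ cong (_% p) (+-comm (fib t) (fib (suc t))) ⟩
    fib (suc (suc t)) % p       ≡⟨ f₂≈1 ⟩
    1 % p                       ≡⟨ +-cong {1} refl f₁≈0 ⟨
    (1 + fib (suc t)) % p       ∎)

  fib-mid≈0 : ∀ t → fib t ≈ 1 → fib (suc (suc t)) ≈ 1 → fib (suc t) ≈ 0
  fib-mid≈0 t f₀≈1 f₂≈1 = +-cancelʳ-≈ (fib t) (trans f₂≈1 (sym f₀≈1))

  oddFib-ones⇔FibPeriod : ∀ n → (oddFib (suc n) ≈ 1 × oddFib (suc (suc n)) ≈ 1) ⇔ FibPeriod (suc n + suc n)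
  oddFib-ones⇔FibPeriod n rewrite +-suc n n =
    mk⇔ (λ (f₀≈1 , f₂≈1) → fib-mid≈0 (suc (n + n)) f₀≈1 f₂≈1 , f₂≈1)
        (λ period@(_ , f₂≈1) → FibPeriod⇒fib-pred≈1 (suc (n + n)) period , f₂≈1)

  orbit-returns⇔FibPeriod : ∀ i {G} → IsOrbit (rot p i) (1 , 1 , 1) G →
                            ∀ n → 0 < n → G n ≋ (1 , 1 , 1) ⇔ FibPeriod (n + n)
  orbit-returns⇔FibPeriod i orbit (suc n) _ =
    oddFib-ones⇔FibPeriod n ⇔-∘ orbit-returns⇔oddFib-ones i orbit (suc n)

  odd-¬FibPeriod : 2 < p → ∀ m → ¬ FibPeriod (suc (m + m))
  odd-¬FibPeriod 2<p m period@(f₁≈0 , f₂≈1) = 1+n≢0 (≈⇒≡ 2<p (<-trans (s≤s z≤n) 2<p) 2≈0)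
    where
    2≈0 : 2 ≈ 0
    2≈0 = begin
      2 % p
        ≡⟨ +-cong (*-cong (FibPeriod⇒fib-pred≈1 (m + m) period) f₂≈1) (cong (_% p) (evenBit-double m)) ⟨
      (fib (m + m) * fib (suc (suc (m + m))) + evenBit (m + m)) % p
        ≡⟨ cong (_% p) (cassini (m + m)) ⟩
      (fib (suc (m + m)) * fib (suc (m + m)) + evenBit (suc (m + m))) % p
        ≡⟨ +-cong (*-cong f₁≈0 f₁≈0) (cong (_% p) (evenBit-suc-double m)) ⟩
      0 % p
        ∎

  FibPeriod-even : 2 < p → ∀ {k} → FibPeriod k → k ≡ k / 2 + k / 2
  FibPeriod-even 2<p {k} period with half-or-odd k
  ... | inj₁ k≡2h = k≡2h
  ... | inj₂ k≡2h+1 = ⊥-elim (odd-¬FibPeriod 2<p (k / 2) (subst FibPeriod k≡2h+1 period))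

  IsPisanoPeriod⇒LeastPositive : ∀ {k} → IsPisanoPeriod p k → LeastPositive FibPeriod k
  IsPisanoPeriod⇒LeastPositive (0<k , f₀ , f₁ , least) =
    0<k , (f₀ , f₁) , λ m 0<m m<k (g₀ , g₁) → least m 0<m m<k g₀ g₁

proposition3p3 : (p : ℕ) .{{_ : NonZero p}} → Prime p → 5 < p →
    (i : Fin 3) → (k : ℕ) → IsPisanoPeriod p k →
    IsOrd p i (1 , 1 , 1) (k / 2)
proposition3p3 p _ 5<p i k pisano =
  -- IsOrd iterates rot i by a function local to its definition; the orbit
  -- lemmas hold for any G obeying the same equations, so Agda unifies G with it.
  LeastPositive-half (orbit-returns⇔FibPeriod p i (refl , λ _ → refl))
    (subst (LeastPositive (FibPeriod p)) (FibPeriod-even p 2<p (proj₁ (proj₂ least))) least)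
  where
  2<p : 2 < p
  2<p = <-trans (s≤s (s≤s (s≤s z≤n))) 5<p
  least : LeastPositive (FibPeriod p) k
  least = IsPisanoPeriod⇒LeastPositive p pisano
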